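{- Let $s,t\ge 3$. Then $\check s(C_s\,\Box\, P_t)=4$ if $s$ and $t$ are both odd, and $\check s(C_s\,\Box\, P_t)=2$ otherwise.
   Context: $C_s$ is the cycle on $s$ vertices and $P_t$ the path on $t$ vertices. A proper edge-coloring assigns colors to edges so that incident edges receive different colors. For a proper edge-coloring $f$, the palette of $v$ is $P_f(v)=\{f(e): e \text{ incident to } v\}$. The palette index $\check s(G)$ is the minimum over proper edge-colorings of the number of distinct vertex palettes. The Cartesian product $G\,\Box\, H$ has vertex set $V(G)\times V(H)$, with $(x_1,x_2)(y_1,y_2)$ an edge iff either $x_1y_1\in E(G)$ and $x_2=y_2$, or $x_2y_2\in E(H)$ and $x_1=y_1$. -}

module Defs where

open import Data.Nat using (ℕ; zero; suc; _+_; _%_; _≤_)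
open import Data.Fin using (Fin; toℕ)
open import Data.Product using (Σ; ∃; _×_; _,_)
open import Data.Sum using (_⊎_)
open import Relation.Binary.PropositionalEquality using (_≡_; _≢_)
open import Relation.Nullary using (¬_)
open import Function.Bundles using (_⇔_)

-- A graph: a vertex type with an adjacency relation (all graphs used below
-- have symmetric, irreflexive adjacency by construction).
record Graph : Set₁ where
  field
    V   : Set
    Adj : V → V → Set
open Graph public

CycSucc : (s : ℕ) → Fin s → Fin s → Set
CycSucc s i j = (toℕ j ≡ suc (toℕ i)) ⊎ (suc (toℕ i) ≡ s × toℕ j ≡ 0)

CycAdj : (s : ℕ) → Fin s → Fin s → Set
CycAdj s i j = CycSucc s i j ⊎ CycSucc s j i

PathAdj : (t : ℕ) → Fin t → Fin t → Set
PathAdj t i j = (toℕ j ≡ suc (toℕ i)) ⊎ (toℕ i ≡ suc (toℕ j))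

BoxAdj : {A B : Set} → (A → A → Set) → (B → B → Set) → A × B → A × B → Set
BoxAdj RA RB (x₁ , x₂) (y₁ , y₂) = (RA x₁ y₁ × x₂ ≡ y₂) ⊎ (RB x₂ y₂ × x₁ ≡ y₁)

record EdgeColoring (G : Graph) : Set where
  field
    col  : V G → V G → ℕ
    symm : ∀ {u v} → Adj G u v → col u v ≡ col v u
open EdgeColoring public

Proper : (G : Graph) → EdgeColoring G → Set
Proper G f = ∀ {u v w} → Adj G u v → Adj G u w → v ≢ w → col f u v ≢ col f u w

Palette : (G : Graph) → EdgeColoring G → V G → ℕ → Set
Palette G f v k = ∃ λ u → Adj G v u × col f v u ≡ k

SamePalette : (G : Graph) → EdgeColoring G → V G → V G → Set
SamePalette G f u v = ∀ k → Palette G f u k ⇔ Palette G f v k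

-- f has at most k distinct vertex palettes: there are k vertices whose
-- palettes cover all palettes occurring.
AtMostPalettes : (G : Graph) → EdgeColoring G → ℕ → Set
AtMostPalettes G f k =
  Σ (Fin k → V G) λ r → ∀ v → ∃ λ i → SamePalette G f v (r i)

PaletteIndex : Graph → ℕ → Set
PaletteIndex G n =
  (Σ (EdgeColoring G) λ f → Proper G f × AtMostPalettes G f n)
  × (∀ (f : EdgeColoring G) → Proper G f → ∀ m → suc m ≤ n → ¬ AtMostPalettes G f m)

-- C_s □ P_t  (simple when s ≥ 3)
CycBoxPath : (s t : ℕ) → Graph
CycBoxPath s t = record
  { V   = Fin s × Fin t
  ; Adj = BoxAdj (CycAdj s) (PathAdj t)
  }

Odd : ℕ → Set
Odd n = n % 2 ≡ 1

-- A proper colouring gives each vertex as many colours as neighbours, so a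
-- vertex of the bottom or top row (degree 3) never shares its palette with an
-- interior vertex (degree 4); this is the lower bound 2.  If s and t are odd
-- and at most three palettes occur, count modulo 2, for each colour κ, the
-- vertices whose palette contains κ: every κ-edge is counted at both ends, so
-- the count is even.  There are 2s boundary vertices and an odd number
-- s(t − 2) of interior ones, which rules out one boundary palette with at most
-- two interior ones, and otherwise (boundary palettes P, P′, interior palette
-- Q) forces Q = P △ P′.  As |Q| = 4 and |P| = |P′| = 3, some colour x lies in
-- every boundary palette and in no interior one; along the bottom row the
-- x-edges then form a perfect matching of the odd cycle C_s, which is absurd.
-- The upper bounds are explicit colourings in which the colour of an edge only
-- depends on the types of its row and column, so that properness and the
-- palettes are a finite check over the combinations of types.

module Submission where

open import Defs
open import Algebra.Bundles using (CommutativeRing)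
open import Data.Bool using (Bool; true; false; not; _∧_; _xor_; if_then_else_)
open import Data.Bool.Properties
  using (not-involutive; not-¬; not-distribˡ-xor; xor-identityʳ; xor-same; xor-∧-commutativeRing)
import Data.Bool.Properties as Bool
open import Data.Empty using (⊥; ⊥-elim)
open import Data.Fin using (Fin; zero; suc; toℕ; fromℕ; fromℕ<; inject₁; pred)
open import Data.Fin.Properties using (toℕ-injective; toℕ<n; toℕ-fromℕ; toℕ-fromℕ<; toℕ-inject₁; any?)
import Data.Fin.Properties as Fin
open import Data.List using (List; []; _∷_; length; map; filter; catMaybes)
open import Data.List.Properties using (filter-notAll; length-map; length-tabulate)
open import Data.List.Membership.Propositional using (_∈_)
open import Data.List.Membership.Propositional.Properties using (∈-filter⁺; ∈-allFin; ∈-map⁻)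
open import Data.List.Relation.Binary.Subset.Propositional using (_⊆_)
open import Data.List.Relation.Unary.All as All using (All; []; _∷_)
open import Data.List.Relation.Unary.All.Properties using (¬Any⇒All¬)
open import Data.List.Relation.Unary.AllPairs as AllPairs using (AllPairs; []; _∷_; allPairs?)
import Data.List.Relation.Unary.AllPairs.Properties as AllPairsₚ
open import Data.List.Relation.Unary.Any using (here; there)
import Data.List.Relation.Unary.Any as Any
open import Data.Maybe using (Maybe; just; nothing)
import Data.Maybe as Maybe
open import Data.Nat using (ℕ; zero; suc; _+_; _≤_; _<_; _∸_; z≤n; s≤s; s≤s⁻¹; _<?_)
import Data.Nat as ℕ
open import Data.Nat.Properties
  using (≤-trans; ≤-antisym; <-irrefl; <-trans; n<1+n; ≤∧≢⇒<; ≮⇒≥; ≰⇒>; suc-injective; 1+n≢0; 1+n≢n;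
         n≢0⇒n>0; n∸n≡0; m∸n+n≡m)
open import Data.List.Relation.Binary.Subset.DecPropositional ℕ._≟_ using (_⊆?_)
open import Data.Product using (Σ; ∃; _×_; _,_; proj₁; proj₂)
open import Data.Product.Properties using (≡-dec)
open import Data.Sum using (_⊎_; inj₁; inj₂)
open import Data.Unit using (⊤; tt)
open import Function using (_∘_; _⇔_; mk⇔; Equivalence)
open import Relation.Binary using (DecidableEquality)
open import Relation.Binary.PropositionalEquality
  using (_≡_; _≢_; refl; sym; trans; cong; cong₂; subst; subst₂; module ≡-Reasoning)
open import Relation.Nullary using (¬_; Dec; yes; no; ¬?)
open import Relation.Nullary.Decidable using (does; toWitness; dec-true; dec-false; _⊎-dec_; _×-dec_)
open import Algebra.Properties.Semiring.Sum (CommutativeRing.semiring xor-∧-commutativeRing)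
  using (sum-syntax; sum-cong-≗; sum-replicate-zero; ∑-distrib-+; ∑-comm; *-distribʳ-sum)
open ≡-Reasoning

-- Pigeonhole for pairwise distinct values

module _ {A : Set} (_≟_ : DecidableEquality A) where

  distinct-⊆⇒length-≤ : {xs ys : List A} → AllPairs _≢_ xs → All (_∈ ys) xs → length xs ≤ length ys
  distinct-⊆⇒length-≤ {[]} _ _ = z≤n
  distinct-⊆⇒length-≤ {x ∷ xs} {ys} (x≢xs ∷ distinct) (x∈ys ∷ xs⊆ys) =
    ≤-trans (s≤s (distinct-⊆⇒length-≤ distinct (All.zipWith keep (x≢xs , xs⊆ys))))
            (filter-notAll (λ y → ¬? (y ≟ x)) ys (Any.map (λ y≡x x≢y → x≢y (sym y≡x)) x∈ys))
    where
    keep : ∀ {y} → x ≢ y × y ∈ ys → y ∈ filter (λ y → ¬? (y ≟ x)) ys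
    keep (x≢y , y∈ys) = ∈-filter⁺ (λ y → ¬? (y ≟ x)) y∈ys (x≢y ∘ sym)

distinct-Fin⇒length-≤ : ∀ {k} {xs : List (Fin k)} → AllPairs _≢_ xs → length xs ≤ k
distinct-Fin⇒length-≤ {k} {xs} distinct =
  subst (length xs ≤_) (length-tabulate {n = k} (λ i → i))
        (distinct-⊆⇒length-≤ Fin._≟_ distinct (All.tabulate (λ {x} _ → ∈-allFin x)))

fin≤3-third : ∀ {k} → k ≤ 3 → {a b c x : Fin k} →
              AllPairs _≢_ (a ∷ b ∷ c ∷ []) → x ≢ a → x ≢ b → x ≡ c
fin≤3-third k≤3 {a} {b} {c} {x} ((a≢b ∷ a≢c ∷ []) ∷ (b≢c ∷ []) ∷ [] ∷ []) x≢a x≢b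
  with x Fin.≟ c
... | yes x≡c = x≡c
... | no x≢c = ⊥-elim (<-irrefl refl (≤-trans (distinct-Fin⇒length-≤ four-distinct) k≤3))
  where
  four-distinct : AllPairs _≢_ (a ∷ b ∷ c ∷ x ∷ [])
  four-distinct =
    (a≢b ∷ a≢c ∷ x≢a ∘ sym ∷ []) ∷ (b≢c ∷ x≢b ∘ sym ∷ []) ∷ (x≢c ∘ sym ∷ []) ∷ [] ∷ []

module _ {G : Graph} {f : EdgeColoring G} where

  samePalette-sym : ∀ {v w} → SamePalette G f v w → SamePalette G f w v
  samePalette-sym same k = mk⇔ (Equivalence.from (same k)) (Equivalence.to (same k))

  samePalette-trans : ∀ {u v w} → SamePalette G f u v → SamePalette G f v w → SamePalette G f u w
  samePalette-trans uv vw k = mk⇔ (Equivalence.to (vw k) ∘ Equivalence.to (uv k))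
                                  (Equivalence.from (uv k) ∘ Equivalence.from (vw k))

  module Classes {k} (cover : AtMostPalettes G f k) where

    class : V G → Fin k
    class v = proj₁ (proj₂ cover v)

    same-class⇒samePalette : ∀ {v w} → class v ≡ class w → SamePalette G f v w
    same-class⇒samePalette {v} {w} v~w =
      samePalette-trans (proj₂ (proj₂ cover v))
        (subst (λ a → SamePalette G f (proj₁ cover a) w) (sym v~w) (samePalette-sym (proj₂ (proj₂ cover w))))

    distinct-palettes⇒≤ : ∀ {vs} → AllPairs (λ v w → ¬ SamePalette G f v w) vs → length vs ≤ k
    distinct-palettes⇒≤ {vs} distinct =
      subst (_≤ k) (length-map class vs)
            (distinct-Fin⇒length-≤
              (AllPairsₚ.map⁺ (AllPairs.map (λ ¬same → ¬same ∘ same-class⇒samePalette) distinct)))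

-- Parities of finite sums

false≢true : false ≢ true
false≢true ()

∧-true : ∀ {a b} → a ∧ b ≡ true → a ≡ true × b ≡ true
∧-true {true} {true} _ = refl , refl

true∧¬true⇒false : ∀ {a b} → a ≡ true → a ∧ b ≢ true → b ≡ false
true∧¬true⇒false {b = false} _    _ = refl
true∧¬true⇒false {b = true}  refl ¬both = ⊥-elim (¬both refl)

¬true∧true⇒false : ∀ {a b} → b ≡ true → a ∧ b ≢ true → a ≡ false
¬true∧true⇒false {a = false} _    _ = refl
¬true∧true⇒false {a = true}  refl ¬both = ⊥-elim (¬both refl)

xor-solve : ∀ a b c → a xor (b xor c) ≡ false → c ≡ a xor b
xor-solve false false false _ = refl
xor-solve false true  true  _ = refl
xor-solve true  false true  _ = refl
xor-solve true  true  false _ = refl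

∧-xor-not : ∀ b c → (b ∧ c) xor (b ∧ not c) ≡ b
∧-xor-not false _     = refl
∧-xor-not true  false = refl
∧-xor-not true  true  = refl

xor≡false⇒≡ : ∀ {a b} → a xor b ≡ false → a ≡ b
xor≡false⇒≡ {false} {false} _ = refl
xor≡false⇒≡ {true}  {true}  _ = refl

xor≡true⇒≡not : ∀ {a b} → a xor b ≡ true → b ≡ not a
xor≡true⇒≡not {false} {true}  _ = refl
xor≡true⇒≡not {true}  {false} _ = refl

parity : ℕ → Bool
parity zero = false
parity (suc n) = not (parity n)

odd⇒parity : ∀ n → Odd n → parity n ≡ true
odd⇒parity 1 _ = refl
odd⇒parity (suc (suc n)) odd = trans (not-involutive (parity n)) (odd⇒parity n odd)

parity⇒odd : ∀ n → parity n ≡ true → Odd n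
parity⇒odd 1 _ = refl
parity⇒odd (suc (suc n)) p = parity⇒odd n (trans (sym (not-involutive (parity n))) p)

odd-suc⇒parity≡false : ∀ n → Odd (suc n) → parity n ≡ false
odd-suc⇒parity≡false n odd = trans (sym (not-involutive (parity n))) (cong not (odd⇒parity (suc n) odd))

does-true : ∀ {A : Set} (a? : Dec A) → does a? ≡ true → A
does-true (yes a) _ = a

does-cong : ∀ {A B : Set} → (A → B) → (B → A) → (a? : Dec A) (b? : Dec B) → does a? ≡ does b?
does-cong _   _   (yes _) (yes _) = refl
does-cong _   _   (no _)  (no _)  = refl
does-cong a→b _   (yes a) (no ¬b) = ⊥-elim (¬b (a→b a))
does-cong _   b→a (no ¬a) (yes b) = ⊥-elim (¬a (b→a b))

-- Sums are taken in the Boolean ring (xor, ∧): ∑ computes the parity of a count.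

∑-cong : ∀ {k} {f g : Fin k → Bool} → (∀ i → f i ≡ g i) → ∑[ i < k ] f i ≡ ∑[ i < k ] g i
∑-cong = sum-cong-≗

∑-false : ∀ k → ∑[ i < k ] false ≡ false
∑-false = sum-replicate-zero

∑-const : ∀ k b → ∑[ i < k ] b ≡ b ∧ parity k
∑-const k false = ∑-false k
∑-const zero true = refl
∑-const (suc k) true = cong not (∑-const k true)

∑-∧ : ∀ {k} (f : Fin k → Bool) b → ∑[ i < k ] (f i ∧ b) ≡ (∑[ i < k ] f i) ∧ b
∑-∧ f b = sym (*-distribʳ-sum b f)

∑-delta : ∀ {k} {f : Fin k → Bool} i₀ → (∀ i → i ≢ i₀ → f i ≡ false) → ∑[ i < k ] f i ≡ f i₀
∑-delta {suc k} {f} zero off =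
  trans (cong (f zero xor_) (trans (∑-cong (λ i → off (suc i) λ ())) (∑-false k))) (xor-identityʳ (f zero))
∑-delta {suc k} {f} (suc i₀) off =
  trans (cong (_xor ∑[ i < k ] f (suc i)) (off zero λ ()))
        (∑-delta i₀ (λ i i≢i₀ → off (suc i) (i≢i₀ ∘ Fin.suc-injective)))

∑-true : ∀ {k} (f : Fin k → Bool) → ∑[ i < k ] f i ≡ true → ∃ λ i → f i ≡ true
∑-true {suc k} f total with f zero in f0
... | true = zero , f0
... | false with ∑-true (f ∘ suc) total
...   | i , fi = suc i , fi

handshake : ∀ {k} (g : Fin k → Fin k → Bool) → (∀ x y → g x y ≡ g y x) → (∀ x → g x x ≡ false) →
            ∑[ x < k ] ∑[ y < k ] g x y ≡ false
handshake {zero} _ _ _ = refl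
handshake {suc k} g g-sym g-diag = begin
  (g zero zero xor A) xor ∑[ x < k ] (g (suc x) zero xor ∑[ y < k ] g (suc x) (suc y))
    ≡⟨ cong₂ _xor_ (cong (_xor A) (g-diag zero))
                   (∑-distrib-+ (λ x → g (suc x) zero) (λ x → ∑[ y < k ] g (suc x) (suc y))) ⟩
  A xor (∑[ x < k ] g (suc x) zero xor ∑[ x < k ] ∑[ y < k ] g (suc x) (suc y))
    ≡⟨ cong₂ (λ a b → A xor (a xor b)) (∑-cong (λ x → g-sym (suc x) zero))
             (handshake (λ x y → g (suc x) (suc y)) (λ x y → g-sym (suc x) (suc y)) (g-diag ∘ suc)) ⟩
  A xor (A xor false)
    ≡⟨ trans (cong (A xor_) (xor-identityʳ A)) (xor-same A) ⟩
  false ∎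
  where
  A : Bool
  A = ∑[ y < k ] g zero (suc y)

module Sum² (a b : ℕ) where

  opaque
    ∑² : (Fin a × Fin b → Bool) → Bool
    ∑² f = ∑[ i < a ] ∑[ j < b ] f (i , j)

  opaque
    unfolding ∑²

    ∑²-cong : ∀ {f g} → (∀ v → f v ≡ g v) → ∑² f ≡ ∑² g
    ∑²-cong f≗g = ∑-cong (λ i → ∑-cong (λ j → f≗g (i , j)))

    ∑²-xor : ∀ f g → ∑² (λ v → f v xor g v) ≡ ∑² f xor ∑² g
    ∑²-xor f g = trans (∑-cong (λ i → ∑-distrib-+ (λ j → f (i , j)) (λ j → g (i , j))))
                       (∑-distrib-+ (λ i → ∑[ j < b ] f (i , j)) (λ i → ∑[ j < b ] g (i , j)))

    ∑²-∧ : ∀ f x → ∑² (λ v → f v ∧ x) ≡ ∑² f ∧ x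
    ∑²-∧ f x = trans (∑-cong (λ i → ∑-∧ (λ j → f (i , j)) x))
                     (∑-∧ (λ i → ∑[ j < b ] f (i , j)) x)

    ∑²-delta : ∀ {f} u → (∀ v → v ≢ u → f v ≡ false) → ∑² f ≡ f u
    ∑²-delta (i₀ , j₀) off =
      trans (∑-delta i₀ (λ i i≢i₀ → trans (∑-cong (λ j → off (i , j) (i≢i₀ ∘ cong proj₁)))
                                           (∑-false b)))
            (∑-delta j₀ (λ j j≢j₀ → off (i₀ , j) (j≢j₀ ∘ cong proj₂)))

    ∑²-true : ∀ f → ∑² f ≡ true → ∃ λ v → f v ≡ true
    ∑²-true f total with ∑-true _ total
    ... | i , row with ∑-true _ row
    ...   | j , fij = (i , j) , fij

    ∑²-handshake : (g : Fin a × Fin b → Fin a × Fin b → Bool) →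
                   (∀ v u → g v u ≡ g u v) → (∀ v → g v v ≡ false) →
                   ∑² (λ v → ∑² (g v)) ≡ false
    ∑²-handshake g g-sym g-diag =
      trans (∑-cong (λ i → ∑-comm (λ j i′ → ∑[ j′ < b ] g (i , j) (i′ , j′))))
            (handshake H H-sym H-diag)
      where
      H : Fin a → Fin a → Bool
      H i i′ = ∑[ j < b ] ∑[ j′ < b ] g (i , j) (i′ , j′)
      H-sym : ∀ i i′ → H i i′ ≡ H i′ i
      H-sym i i′ = trans (∑-cong (λ j → ∑-cong (λ j′ → g-sym (i , j) (i′ , j′))))
                         (∑-comm (λ j j′ → g (i′ , j′) (i , j)))
      H-diag : ∀ i → H i i ≡ false
      H-diag i = handshake (λ j j′ → g (i , j) (i , j′)) (λ j j′ → g-sym _ _) (λ j → g-diag (i , j))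

    ∑²-proj₂ : ∀ (g : Fin b → Bool) → ∑² (g ∘ proj₂) ≡ (∑[ j < b ] g j) ∧ parity a
    ∑²-proj₂ g = ∑-const a (∑[ j < b ] g j)

  ∑²-split : ∀ (p q : Fin a × Fin b → Bool) →
             ∑² (λ v → p v ∧ q v) xor ∑² (λ v → p v ∧ not (q v)) ≡ ∑² p
  ∑²-split p q = trans (sym (∑²-xor (λ v → p v ∧ q v) (λ v → p v ∧ not (q v))))
                       (∑²-cong (λ v → ∧-xor-not (p v) (q v)))

  ∑²-regions : ∀ (p q : Fin a × Fin b → Bool) (x y z : Bool) →
               ∑² (λ v → if p v then (if q v then x else y) else z)
               ≡ (∑² (λ v → p v ∧ q v) ∧ x) xor (∑² (λ v → p v ∧ not (q v)) ∧ y)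
                 xor (∑² (not ∘ p) ∧ z)
  ∑²-regions p q x y z = begin
    ∑² (λ v → if p v then (if q v then x else y) else z)
      ≡⟨ ∑²-cong pointwise ⟩
    ∑² (λ v → R₁ v xor R₂ v xor R₃ v)
      ≡⟨ trans (∑²-xor R₁ (λ v → R₂ v xor R₃ v)) (cong (∑² R₁ xor_) (∑²-xor R₂ R₃)) ⟩
    ∑² R₁ xor ∑² R₂ xor ∑² R₃
      ≡⟨ cong₂ _xor_ (∑²-∧ (λ v → p v ∧ q v) x)
                     (cong₂ _xor_ (∑²-∧ (λ v → p v ∧ not (q v)) y) (∑²-∧ (not ∘ p) z)) ⟩
    (∑² (λ v → p v ∧ q v) ∧ x) xor (∑² (λ v → p v ∧ not (q v)) ∧ y) xor (∑² (not ∘ p) ∧ z) ∎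
    where
    R₁ R₂ R₃ : Fin a × Fin b → Bool
    R₁ v = (p v ∧ q v) ∧ x
    R₂ v = (p v ∧ not (q v)) ∧ y
    R₃ v = not (p v) ∧ z
    pointwise : ∀ v → (if p v then (if q v then x else y) else z)
                      ≡ ((p v ∧ q v) ∧ x) xor ((p v ∧ not (q v)) ∧ y) xor (not (p v) ∧ z)
    pointwise v with p v | q v
    ... | true  | true  = sym (xor-identityʳ x)
    ... | true  | false = sym (xor-identityʳ y)
    ... | false | _     = refl

-- The grid C_s □ P_t

data Dir : Set where
  right left up down : Dir

opposite : Dir → Dir
opposite right = left
opposite left  = right
opposite up    = down
opposite down  = up

n≢2+n : ∀ {x : ℕ} → x ≢ suc (suc x)
n≢2+n {suc x} e = n≢2+n (suc-injective e)

module Cycle (n : ℕ) where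

  cycSucc-functional : ∀ {i j j′} → CycSucc (suc n) i j → CycSucc (suc n) i j′ → j ≡ j′
  cycSucc-functional (inj₁ a) (inj₁ b) = toℕ-injective (trans a (sym b))
  cycSucc-functional {j = j} (inj₁ a) (inj₂ (b , _)) = ⊥-elim (<-irrefl (trans a b) (toℕ<n j))
  cycSucc-functional {j′ = j′} (inj₂ (a , _)) (inj₁ b) = ⊥-elim (<-irrefl (trans b a) (toℕ<n j′))
  cycSucc-functional (inj₂ (_ , a)) (inj₂ (_ , b)) = toℕ-injective (trans a (sym b))

  cycSucc-injective : ∀ {i i′ j} → CycSucc (suc n) i j → CycSucc (suc n) i′ j → i ≡ i′
  cycSucc-injective (inj₁ a) (inj₁ b) = toℕ-injective (suc-injective (trans (sym a) b))
  cycSucc-injective (inj₁ a) (inj₂ (_ , b)) = ⊥-elim (1+n≢0 (trans (sym a) b))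
  cycSucc-injective (inj₂ (_ , a)) (inj₁ b) = ⊥-elim (1+n≢0 (trans (sym b) a))
  cycSucc-injective (inj₂ (a , _)) (inj₂ (b , _)) = toℕ-injective (suc-injective (trans a (sym b)))

  next : Fin (suc n) → Fin (suc n)
  next i with suc (toℕ i) <? suc n
  ... | yes i+1<s = fromℕ< i+1<s
  ... | no _      = zero

  next-succ : ∀ i → CycSucc (suc n) i (next i)
  next-succ i with suc (toℕ i) <? suc n
  ... | yes i+1<s = inj₁ (toℕ-fromℕ< i+1<s)
  ... | no i+1≮s  = inj₂ (≤-antisym (toℕ<n i) (≮⇒≥ i+1≮s) , refl)

  prev : Fin (suc n) → Fin (suc n)
  prev zero    = fromℕ n
  prev (suc i) = inject₁ i

  prev-succ : ∀ i → CycSucc (suc n) (prev i) i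
  prev-succ zero    = inj₂ (cong suc (toℕ-fromℕ n) , refl)
  prev-succ (suc i) = inj₁ (cong suc (sym (toℕ-inject₁ i)))

  alternation-parity : (e : Fin (suc n) → Bool) → (∀ {i i′} → CycSucc (suc n) i i′ → e i′ ≡ not (e i)) →
                       ∀ k (k<s : k < suc n) → e (fromℕ< k<s) ≡ parity k xor e zero
  alternation-parity e flip zero    _     = refl
  alternation-parity e flip (suc k) k+1<s = begin
    e (fromℕ< k+1<s)
      ≡⟨ flip (inj₁ (trans (toℕ-fromℕ< k+1<s) (cong suc (sym (toℕ-fromℕ< k<s))))) ⟩
    not (e (fromℕ< k<s))      ≡⟨ cong not (alternation-parity e flip k k<s) ⟩
    not (parity k xor e zero) ≡⟨ not-distribˡ-xor (parity k) (e zero) ⟩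
    parity (suc k) xor e zero ∎
    where
    k<s : k < suc n
    k<s = <-trans (n<1+n k) k+1<s

  odd-cycle-no-alternation : Odd (suc n) → (e : Fin (suc n) → Bool) →
                             ¬ (∀ {i i′} → CycSucc (suc n) i i′ → e i′ ≡ not (e i))
  odd-cycle-no-alternation odd e flip = not-¬ refl (begin
    e zero                    ≡⟨ flip (inj₂ (cong suc (toℕ-fromℕ< (n<1+n n)) , refl)) ⟩
    not (e (fromℕ< (n<1+n n))) ≡⟨ cong not (alternation-parity e flip n (n<1+n n)) ⟩
    not (parity n xor e zero) ≡⟨ not-distribˡ-xor (parity n) (e zero) ⟩
    parity (suc n) xor e zero ≡⟨ cong (_xor e zero) (odd⇒parity (suc n) odd) ⟩
    not (e zero)              ∎)

  module _ (2≤n : 2 ≤ n) where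

    private
      n≢0 : n ≢ 0
      n≢0 refl = <-irrefl refl (≤-trans (s≤s z≤n) 2≤n)

      n≢1 : n ≢ 1
      n≢1 refl = <-irrefl refl 2≤n

    cycSucc-irrefl : ∀ {i} → ¬ CycSucc (suc n) i i
    cycSucc-irrefl (inj₁ e) = 1+n≢n (sym e)
    cycSucc-irrefl (inj₂ (last , first)) = n≢0 (trans (sym (suc-injective last)) first)

    cycSucc-asym : ∀ {i j} → CycSucc (suc n) i j → ¬ CycSucc (suc n) j i
    cycSucc-asym (inj₁ a) (inj₁ b) = n≢2+n (trans b (cong suc a))
    cycSucc-asym (inj₁ a) (inj₂ (b , c)) = n≢1 (trans (sym (suc-injective b)) (trans a (cong suc c)))
    cycSucc-asym (inj₂ (b , c)) (inj₁ a) = n≢1 (trans (sym (suc-injective b)) (trans a (cong suc c)))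
    cycSucc-asym (inj₂ (_ , c)) (inj₂ (b , _)) = n≢0 (trans (sym (suc-injective b)) c)

-- Columns are Fin (suc n) and rows Fin (suc m): s = suc n and t = suc m.

module Grid (n m : ℕ) where

  open Cycle n public

  Vertex : Set
  Vertex = Fin (suc n) × Fin (suc m)

  G : Graph
  G = CycBoxPath (suc n) (suc m)

  Step : Vertex → Dir → Vertex → Set
  Step (i , j) right (i′ , j′) = CycSucc (suc n) i i′ × j ≡ j′
  Step (i , j) left  (i′ , j′) = CycSucc (suc n) i′ i × j ≡ j′
  Step (i , j) up    (i′ , j′) = toℕ j′ ≡ suc (toℕ j) × i ≡ i′
  Step (i , j) down  (i′ , j′) = toℕ j ≡ suc (toℕ j′) × i ≡ i′

  adj⇒step : ∀ {v u} → Adj G v u → ∃ λ d → Step v d u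
  adj⇒step {_ , _} {_ , _} (inj₁ (inj₁ c , e)) = right , c , e
  adj⇒step {_ , _} {_ , _} (inj₁ (inj₂ c , e)) = left , c , e
  adj⇒step {_ , _} {_ , _} (inj₂ (inj₁ c , e)) = up , c , e
  adj⇒step {_ , _} {_ , _} (inj₂ (inj₂ c , e)) = down , c , e

  step⇒adj : ∀ {v u} d → Step v d u → Adj G v u
  step⇒adj {_ , _} {_ , _} right (c , e) = inj₁ (inj₁ c , e)
  step⇒adj {_ , _} {_ , _} left  (c , e) = inj₁ (inj₂ c , e)
  step⇒adj {_ , _} {_ , _} up    (c , e) = inj₂ (inj₁ c , e)
  step⇒adj {_ , _} {_ , _} down  (c , e) = inj₂ (inj₂ c , e)

  step-opposite : ∀ {v u} d → Step v d u → Step u (opposite d) v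
  step-opposite {_ , _} {_ , _} right (c , e) = c , sym e
  step-opposite {_ , _} {_ , _} left  (c , e) = c , sym e
  step-opposite {_ , _} {_ , _} up    (c , e) = c , sym e
  step-opposite {_ , _} {_ , _} down  (c , e) = c , sym e

  step-functional : ∀ {v d u u′} → Step v d u → Step v d u′ → u ≡ u′
  step-functional {_ , j} {right} {_ , _} {_ , _} (a , refl) (b , refl) = cong (_, j) (cycSucc-functional a b)
  step-functional {_ , j} {left}  {_ , _} {_ , _} (a , refl) (b , refl) = cong (_, j) (cycSucc-injective a b)
  step-functional {i , _} {up}    {_ , _} {_ , _} (a , refl) (b , refl) =
    cong (i ,_) (toℕ-injective (trans a (sym b)))
  step-functional {i , _} {down}  {_ , _} {_ , _} (a , refl) (b , refl) =
    cong (i ,_) (toℕ-injective (suc-injective (trans (sym a) b)))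

  step-direction : 2 ≤ n → ∀ {v d d′ u} → Step v d u → Step v d′ u → d ≡ d′
  step-direction 2≤n = go
    where
    go : ∀ {v d d′ u} → Step v d u → Step v d′ u → d ≡ d′
    go {d = right} {right} _ _ = refl
    go {d = left}  {left}  _ _ = refl
    go {d = up}    {up}    _ _ = refl
    go {d = down}  {down}  _ _ = refl
    go {_ , _} {right} {left}  {_ , _} (a , _) (b , _) = ⊥-elim (cycSucc-asym 2≤n a b)
    go {_ , _} {left}  {right} {_ , _} (a , _) (b , _) = ⊥-elim (cycSucc-asym 2≤n a b)
    go {_ , _} {right} {up}    {_ , _} (a , _) (_ , refl) = ⊥-elim (cycSucc-irrefl 2≤n a)
    go {_ , _} {right} {down}  {_ , _} (a , _) (_ , refl) = ⊥-elim (cycSucc-irrefl 2≤n a)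
    go {_ , _} {left}  {up}    {_ , _} (a , _) (_ , refl) = ⊥-elim (cycSucc-irrefl 2≤n a)
    go {_ , _} {left}  {down}  {_ , _} (a , _) (_ , refl) = ⊥-elim (cycSucc-irrefl 2≤n a)
    go {_ , _} {up}    {right} {_ , _} (_ , refl) (a , _) = ⊥-elim (cycSucc-irrefl 2≤n a)
    go {_ , _} {down}  {right} {_ , _} (_ , refl) (a , _) = ⊥-elim (cycSucc-irrefl 2≤n a)
    go {_ , _} {up}    {left}  {_ , _} (_ , refl) (a , _) = ⊥-elim (cycSucc-irrefl 2≤n a)
    go {_ , _} {down}  {left}  {_ , _} (_ , refl) (a , _) = ⊥-elim (cycSucc-irrefl 2≤n a)
    go {_ , _} {up}    {down}  {_ , _} (a , _) (b , _) = ⊥-elim (n≢2+n (trans b (cong suc a)))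
    go {_ , _} {down}  {up}    {_ , _} (a , _) (b , _) = ⊥-elim (n≢2+n (trans a (cong suc b)))

  Avail : Fin (suc m) → Dir → Set
  Avail j right = ⊤
  Avail j left  = ⊤
  Avail j up    = toℕ j < m
  Avail j down  = 0 < toℕ j

  above : Fin (suc m) → Fin (suc m)
  above j with toℕ j <? m
  ... | yes j<m = fromℕ< (s≤s j<m)
  ... | no _    = j

  neighbour : Vertex → Dir → Vertex
  neighbour (i , j) right = next i , j
  neighbour (i , j) left  = prev i , j
  neighbour (i , j) up    = i , above j
  neighbour (i , j) down  = i , pred j

  neighbour-step : ∀ v d → Avail (proj₂ v) d → Step v d (neighbour v d)
  neighbour-step (i , j)     right _ = next-succ i , refl
  neighbour-step (i , j)     left  _ = prev-succ i , refl
  neighbour-step (i , j)     up    j<m with toℕ j <? m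
  ... | yes _  = toℕ-fromℕ< (s≤s j<m) , refl
  ... | no j≮m = ⊥-elim (j≮m j<m)
  neighbour-step (i , suc j) down  _ = cong suc (sym (toℕ-inject₁ j)) , refl

  step-avail : ∀ {v u} d → Step v d u → Avail (proj₂ v) d
  step-avail {_ , _} {_ , _} right _ = tt
  step-avail {_ , _} {_ , _} left  _ = tt
  step-avail {_ , _} {_ , j′} up (e , _) = s≤s⁻¹ (subst (_< suc m) e (toℕ<n j′))
  step-avail {_ , _} {_ , _} down (e , _) = subst (0 <_) (sym e) (s≤s z≤n)

  step-irrefl : 2 ≤ n → ∀ {v} d → ¬ Step v d v
  step-irrefl 2≤n {_ , _} right (c , _) = cycSucc-irrefl 2≤n c
  step-irrefl 2≤n {_ , _} left  (c , _) = cycSucc-irrefl 2≤n c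
  step-irrefl 2≤n {_ , _} up    (c , _) = 1+n≢n (sym c)
  step-irrefl 2≤n {_ , _} down  (c , _) = 1+n≢n (sym c)

  adj-sym : ∀ {v u} → Adj G v u → Adj G u v
  adj-sym v~u with adj⇒step v~u
  ... | d , step = step⇒adj (opposite d) (step-opposite d step)

  adj-irrefl : 2 ≤ n → ∀ {v} → ¬ Adj G v v
  adj-irrefl 2≤n v~v with adj⇒step v~v
  ... | d , step = step-irrefl 2≤n d step

  cycSucc? : ∀ i i′ → Dec (CycSucc (suc n) i i′)
  cycSucc? i i′ = (toℕ i′ ℕ.≟ suc (toℕ i)) ⊎-dec ((suc (toℕ i) ℕ.≟ suc n) ×-dec (toℕ i′ ℕ.≟ 0))

  adj? : ∀ v u → Dec (Adj G v u)
  adj? (i , j) (i′ , j′) =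
    ((cycSucc? i i′ ⊎-dec cycSucc? i′ i) ×-dec (j Fin.≟ j′)) ⊎-dec
    (((toℕ j′ ℕ.≟ suc (toℕ j)) ⊎-dec (toℕ j ℕ.≟ suc (toℕ j′))) ×-dec (i Fin.≟ i′))

  vertex? : ∀ {P : Vertex → Set} → (∀ v → Dec (P v)) → Dec (∃ P)
  vertex? P? with any? (λ i → any? (λ j → P? (i , j)))
  ... | yes (i , j , p) = yes ((i , j) , p)
  ... | no none         = no λ { ((i , j) , p) → none (i , j , p) }

  atMostPalettes : ∀ {f k} (cls : Vertex → Fin k) → (∀ {v w} → cls v ≡ cls w → SamePalette G f v w) →
                   AtMostPalettes G f k
  atMostPalettes {k = k} cls same =
    proj₁ ∘ representative , λ v → cls v , same (sym (proj₂ (representative (cls v)) (v , refl)))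
    where
    representative : (a : Fin k) → Σ Vertex λ w → (∃ λ v → cls v ≡ a) → cls w ≡ a
    representative a with vertex? (λ v → cls v Fin.≟ a)
    ... | yes (w , w~a) = w , λ _ → w~a
    ... | no none       = (zero , zero) , λ found → ⊥-elim (none found)

  _≟ᵛ_ : DecidableEquality Vertex
  _≟ᵛ_ = ≡-dec Fin._≟_ Fin._≟_

  module Colours (f : EdgeColoring G) where

    colourAt : Vertex → Dir → ℕ
    colourAt v d = col f v (neighbour v d)

    colourAt∈palette : ∀ {v} d → Avail (proj₂ v) d → Palette G f v (colourAt v d)
    colourAt∈palette {v} d a = neighbour v d , step⇒adj d (neighbour-step v d a) , refl

    palette⇒colourAt : ∀ {v k} → Palette G f v k → ∃ λ d → Avail (proj₂ v) d × colourAt v d ≡ k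
    palette⇒colourAt {v} (u , v~u , refl) with adj⇒step v~u
    ... | d , step =
      d , step-avail d step , cong (col f v) (step-functional (neighbour-step v d (step-avail d step)) step)

    left≡right : ∀ {i i′ j} → CycSucc (suc n) i i′ → colourAt (i′ , j) left ≡ colourAt (i , j) right
    left≡right {i} {i′} {j} c = begin
      col f (i′ , j) (prev i′ , j) ≡⟨ cong (λ z → col f (i′ , j) (z , j)) (cycSucc-injective (prev-succ i′) c) ⟩
      col f (i′ , j) (i , j)       ≡⟨ symm f (step⇒adj left (c , refl)) ⟩
      col f (i , j) (i′ , j)       ≡⟨ cong (λ z → col f (i , j) (z , j)) (cycSucc-functional c (next-succ i)) ⟩
      col f (i , j) (next i , j)   ∎

    colourAt-injective : 2 ≤ n → Proper G f → ∀ {v d d′} → Avail (proj₂ v) d → Avail (proj₂ v) d′ →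
                         colourAt v d ≡ colourAt v d′ → d ≡ d′
    colourAt-injective 2≤n proper {v} {d} {d′} a a′ same with neighbour v d ≟ᵛ neighbour v d′
    ... | yes u≡u′ =
      step-direction 2≤n (neighbour-step v d a) (subst (Step v d′) (sym u≡u′) (neighbour-step v d′ a′))
    ... | no u≢u′ =
      ⊥-elim (proper (step⇒adj d (neighbour-step v d a)) (step⇒adj d′ (neighbour-step v d′ a′)) u≢u′ same)

-- Lower bounds

module LowerBound (n m : ℕ) (2≤n : 2 ≤ n) (2≤m : 2 ≤ m) where

  open Grid n m
  open Sum² (suc n) (suc m)

  private
    0<m : 0 < m
    0<m = ≤-trans (s≤s z≤n) 2≤m

  -- xor rather than ∨ so that sums split; the two tests never hold together.
  isBoundaryRow : Fin (suc m) → Bool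
  isBoundaryRow j = does (toℕ j ℕ.≟ 0) xor does (toℕ j ℕ.≟ m)

  onBoundary onInterior : Vertex → Bool
  onBoundary = isBoundaryRow ∘ proj₂
  onInterior = not ∘ onBoundary

  isBoundaryRow-true : ∀ {j} → isBoundaryRow j ≡ true → toℕ j ≡ 0 ⊎ toℕ j ≡ m
  isBoundaryRow-true {j} b with toℕ j ℕ.≟ 0 | toℕ j ℕ.≟ m
  ... | yes j≡0 | _       = inj₁ j≡0
  ... | no _    | yes j≡m = inj₂ j≡m
  ... | no j≢0  | no j≢m  =
    ⊥-elim (not-¬ (cong₂ _xor_ (dec-false (toℕ j ℕ.≟ 0) j≢0) (dec-false (toℕ j ℕ.≟ m) j≢m)) b)

  isBoundaryRow-false : ∀ {j} → isBoundaryRow j ≡ false → Avail j up × Avail j down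
  isBoundaryRow-false {j} b with toℕ j ℕ.≟ 0 | toℕ j ℕ.≟ m
  ... | yes j≡0 | yes j≡m = ⊥-elim (<-irrefl (trans (sym j≡0) j≡m) 0<m)
  ... | yes j≡0 | no j≢m  =
    ⊥-elim (not-¬ (cong₂ _xor_ (dec-true (toℕ j ℕ.≟ 0) j≡0) (dec-false (toℕ j ℕ.≟ m) j≢m)) b)
  ... | no j≢0  | yes j≡m =
    ⊥-elim (not-¬ (cong₂ _xor_ (dec-false (toℕ j ℕ.≟ 0) j≢0) (dec-true (toℕ j ℕ.≟ m) j≡m)) b)
  ... | no j≢0  | no j≢m  = ≤∧≢⇒< (s≤s⁻¹ (toℕ<n j)) j≢m , n≢0⇒n>0 j≢0

  boundaryRows-even : ∑[ j < suc m ] isBoundaryRow j ≡ false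
  boundaryRows-even =
    trans (∑-distrib-+ {suc m} (λ j → does (toℕ j ℕ.≟ 0)) (λ j → does (toℕ j ℕ.≟ m)))
          (cong₂ _xor_ (∑-delta {suc m} {f = λ j → does (toℕ j ℕ.≟ 0)} zero off-bottom)
                       (trans (∑-delta {suc m} {f = λ j → does (toℕ j ℕ.≟ m)} (fromℕ m) off-top)
                              (dec-true (toℕ (fromℕ m) ℕ.≟ m) (toℕ-fromℕ m))))
    where
    off-bottom : ∀ j → j ≢ zero → does (toℕ j ℕ.≟ 0) ≡ false
    off-bottom j j≢0 = dec-false (toℕ j ℕ.≟ 0) (j≢0 ∘ toℕ-injective)
    off-top : ∀ j → j ≢ fromℕ m → does (toℕ j ℕ.≟ m) ≡ false
    off-top j j≢m = dec-false (toℕ j ℕ.≟ m) (λ j≡m → j≢m (toℕ-injective (trans j≡m (sym (toℕ-fromℕ m)))))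

  boundary-even : ∑² onBoundary ≡ false
  boundary-even = trans (∑²-proj₂ isBoundaryRow) (cong (_∧ parity (suc n)) boundaryRows-even)

  interior-odd : Odd (suc n) → Odd (suc m) → ∑² onInterior ≡ true
  interior-odd odd-s odd-t = trans (∑²-xor (λ _ → true) onBoundary) (cong₂ _xor_ all-odd boundary-even)
    where
    all-odd : ∑² (λ _ → true) ≡ true
    all-odd = trans (∑²-proj₂ (λ _ → true))
                    (cong₂ _∧_ (trans (∑-const (suc m) true) (odd⇒parity (suc m) odd-t))
                               (odd⇒parity (suc n) odd-s))

  v₀ w₀ : Vertex
  v₀ = zero , zero
  w₀ = zero , fromℕ< (s≤s 0<m)

  v₀-boundary : onBoundary v₀ ≡ true
  v₀-boundary = cong (true xor_) (dec-false (0 ℕ.≟ m) (λ 0≡m → <-irrefl 0≡m 0<m))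

  row₁-interior : ∀ {j} → toℕ j ≡ 1 → isBoundaryRow j ≡ false
  row₁-interior {j} j≡1 =
    cong₂ _xor_ (dec-false (toℕ j ℕ.≟ 0) (1+n≢0 ∘ trans (sym j≡1)))
                (dec-false (toℕ j ℕ.≟ m) (λ j≡m → <-irrefl (trans (sym j≡1) j≡m) 2≤m))

  w₀-interior : onBoundary w₀ ≡ false
  w₀-interior = row₁-interior (toℕ-fromℕ< (s≤s 0<m))

  module _ (f : EdgeColoring G) (proper : Proper G f) where

    open Colours f

    colourAt-apart : ∀ {v} d d′ → Avail (proj₂ v) d → Avail (proj₂ v) d′ → d ≢ d′ →
                     colourAt v d ≢ colourAt v d′
    colourAt-apart _ _ a a′ d≢d′ = d≢d′ ∘ colourAt-injective 2≤n proper a a′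

    coloursAround : Vertex → List ℕ
    coloursAround v = colourAt v right ∷ colourAt v left ∷ colourAt v up ∷ colourAt v down ∷ []

    palette⊆coloursAround : ∀ {v k} → Palette G f v k → k ∈ coloursAround v
    palette⊆coloursAround p with palette⇒colourAt p
    ... | right , _ , refl = here refl
    ... | left  , _ , refl = there (here refl)
    ... | up    , _ , refl = there (there (here refl))
    ... | down  , _ , refl = there (there (there (here refl)))

    interior-coloursAround-distinct : ∀ {w} → onBoundary w ≡ false → AllPairs _≢_ (coloursAround w)
    interior-coloursAround-distinct b with isBoundaryRow-false b
    ... | u , d =
      (colourAt-apart right left tt tt (λ ()) ∷ colourAt-apart right up tt u (λ ()) ∷
       colourAt-apart right down tt d (λ ()) ∷ []) ∷
      (colourAt-apart left up tt u (λ ()) ∷ colourAt-apart left down tt d (λ ()) ∷ []) ∷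
      (colourAt-apart up down u d (λ ()) ∷ []) ∷ [] ∷ []

    interior-coloursAround⊆palette : ∀ {w} → onBoundary w ≡ false → All (Palette G f w) (coloursAround w)
    interior-coloursAround⊆palette b with isBoundaryRow-false b
    ... | u , d =
      colourAt∈palette right tt ∷ colourAt∈palette left tt ∷ colourAt∈palette up u ∷ colourAt∈palette down d ∷ []

    boundary-palette-≤3 : ∀ {v cs} → onBoundary v ≡ true → AllPairs _≢_ cs → All (Palette G f v) cs →
                          length cs ≤ 3
    boundary-palette-≤3 {i , j} b distinct cs⊆palette with isBoundaryRow-true b
    ... | inj₁ j≡0 = distinct-⊆⇒length-≤ ℕ._≟_ distinct (All.map bottom cs⊆palette)
      where
      bottom : ∀ {k} → Palette G f (i , j) k →
               k ∈ colourAt (i , j) right ∷ colourAt (i , j) left ∷ colourAt (i , j) up ∷ []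
      bottom p with palette⇒colourAt p
      ... | right , _ , refl = here refl
      ... | left  , _ , refl = there (here refl)
      ... | up    , _ , refl = there (there (here refl))
      ... | down  , 0<j , _  = ⊥-elim (<-irrefl (sym j≡0) 0<j)
    ... | inj₂ j≡m = distinct-⊆⇒length-≤ ℕ._≟_ distinct (All.map top cs⊆palette)
      where
      top : ∀ {k} → Palette G f (i , j) k →
            k ∈ colourAt (i , j) right ∷ colourAt (i , j) left ∷ colourAt (i , j) down ∷ []
      top p with palette⇒colourAt p
      ... | right , _ , refl = here refl
      ... | left  , _ , refl = there (here refl)
      ... | down  , _ , refl = there (there (here refl))
      ... | up    , j<m , _  = ⊥-elim (<-irrefl j≡m j<m)

    boundary≁interior : ∀ v w → onBoundary v ≡ true → onBoundary w ≡ false → ¬ SamePalette G f v w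
    boundary≁interior _ _ bv iw same =
      <-irrefl refl (boundary-palette-≤3 bv (interior-coloursAround-distinct iw)
                      (All.map (λ {k} → Equivalence.from (same k)) (interior-coloursAround⊆palette iw)))

    incident : ℕ → Vertex → Vertex → Bool
    incident k v u = does (adj? v u ×-dec (col f v u ℕ.≟ k))

    inPalette : ℕ → Vertex → Bool
    inPalette k v = ∑² (incident k v)

    inPalette-sound : ∀ {k v} → inPalette k v ≡ true → Palette G f v k
    inPalette-sound {k} {v} t with ∑²-true (incident k v) t
    ... | u , inc = u , does-true (adj? v u ×-dec (col f v u ℕ.≟ k)) inc

    palette⇒inPalette : ∀ {k v} → Palette G f v k → inPalette k v ≡ true
    palette⇒inPalette {k} {v} (u₀ , adj₀ , col₀) =
      trans (∑²-delta u₀ off) (dec-true (adj? v u₀ ×-dec (col f v u₀ ℕ.≟ k)) (adj₀ , col₀))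
      where
      off : ∀ u → u ≢ u₀ → incident k v u ≡ false
      off u u≢u₀ = dec-false (adj? v u ×-dec (col f v u ℕ.≟ k))
                             (λ (adj , c) → proper adj adj₀ u≢u₀ (trans c (sym col₀)))

    samePalette⇒inPalette : ∀ {v w} → SamePalette G f v w → ∀ k → inPalette k v ≡ inPalette k w
    samePalette⇒inPalette {v} {w} same k with inPalette k v in ev | inPalette k w in ew
    ... | true  | true  = refl
    ... | false | false = refl
    ... | true  | false = trans (sym (palette⇒inPalette (Equivalence.to (same k) (inPalette-sound ev)))) ew
    ... | false | true  = trans (sym ev) (palette⇒inPalette (Equivalence.from (same k) (inPalette-sound ew)))

    -- Every κ-coloured edge is counted at both of its ends.
    inPalette-even : ∀ k → ∑² (inPalette k) ≡ false
    inPalette-even k = ∑²-handshake (incident k) incident-sym incident-irrefl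
      where
      incident-sym : ∀ v u → incident k v u ≡ incident k u v
      incident-sym v u =
        does-cong flip flip (adj? v u ×-dec (col f v u ℕ.≟ k)) (adj? u v ×-dec (col f u v ℕ.≟ k))
        where
        flip : ∀ {x y} → Adj G x y × col f x y ≡ k → Adj G y x × col f y x ≡ k
        flip (adj , c) = adj-sym adj , trans (sym (symm f adj)) c
      incident-irrefl : ∀ v → incident k v v ≡ false
      incident-irrefl v = dec-false (adj? v v ×-dec (col f v v ℕ.≟ k)) (adj-irrefl 2≤n ∘ proj₁)

    region-parity : ∀ (P Q : Vertex → Bool) (x y z : ℕ → Bool) →
                    (∀ κ v → inPalette κ v ≡ (if P v then (if Q v then x κ else y κ) else z κ)) →
                    ∀ κ → (∑² (λ v → P v ∧ Q v) ∧ x κ) xor (∑² (λ v → P v ∧ not (Q v)) ∧ y κ)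
                          xor (∑² (not ∘ P) ∧ z κ) ≡ false
    region-parity P Q x y z profile κ =
      trans (sym (∑²-regions P Q (x κ) (y κ) (z κ))) (trans (sym (∑²-cong (profile κ))) (inPalette-even κ))

    right-colour-inPalette : ∀ v → inPalette (colourAt v right) v ≡ true
    right-colour-inPalette v = palette⇒inPalette {v = v} (colourAt∈palette {v} right tt)

    palettes≥2 : ∀ {k} → AtMostPalettes G f k → 2 ≤ k
    palettes≥2 cover =
      Classes.distinct-palettes⇒≤ {G} {f} cover ((boundary≁interior v₀ w₀ v₀-boundary w₀-interior ∷ []) ∷ [] ∷ [])

    module NoThreePalettes (odd-s : Odd (suc n)) (odd-t : Odd (suc m)) {k} (k≤3 : k ≤ 3)
                           (cover : AtMostPalettes G f k) where

      open Classes {G} {f} cover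

      classes-apart : ∀ v w → onBoundary v ≡ true → onBoundary w ≡ false → class v ≢ class w
      classes-apart v w bv iw = boundary≁interior v w bv iw ∘ same-class⇒samePalette

      a p : Fin k
      a = class v₀
      p = class w₀

      a≢p : a ≢ p
      a≢p = classes-apart v₀ w₀ v₀-boundary w₀-interior

      α π : ℕ → Bool
      α κ = inPalette κ v₀
      π κ = inPalette κ w₀

      same-class⇒inPalette : ∀ {v w} → class v ≡ class w → ∀ κ → inPalette κ v ≡ inPalette κ w
      same-class⇒inPalette v~w = samePalette⇒inPalette (same-class⇒samePalette v~w)

      module TwoBoundaryClasses (u : Vertex) (u-boundary : onBoundary u ≡ true) (u≁v₀ : class u ≢ a) where

        b : Fin k
        b = class u

        α′ : ℕ → Bool
        α′ κ = inPalette κ u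

        interior-class : ∀ w → onBoundary w ≡ false → class w ≡ p
        interior-class w iw =
          fin≤3-third k≤3 ((u≁v₀ ∘ sym ∷ a≢p ∷ []) ∷ (classes-apart u w₀ u-boundary w₀-interior ∷ []) ∷ [] ∷ [])
                      (classes-apart v₀ w v₀-boundary iw ∘ sym) (classes-apart u w u-boundary iw ∘ sym)

        boundary-class : ∀ v → onBoundary v ≡ true → class v ≢ a → class v ≡ b
        boundary-class v bv v≁a =
          fin≤3-third k≤3 ((a≢p ∷ u≁v₀ ∘ sym ∷ []) ∷ (classes-apart u w₀ u-boundary w₀-interior ∘ sym ∷ []) ∷ [] ∷ [])
                      v≁a (classes-apart v w₀ bv w₀-interior)

        σ : Vertex → Bool
        σ v = does (class v Fin.≟ a)

        profile : ∀ κ v → inPalette κ v ≡ (if onBoundary v then (if σ v then α κ else α′ κ) else π κ)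
        profile κ v with onBoundary v in bv | class v Fin.≟ a
        ... | true  | yes v~a = same-class⇒inPalette v~a κ
        ... | true  | no v≁a  = same-class⇒inPalette (boundary-class v bv v≁a) κ
        ... | false | _       = same-class⇒inPalette (interior-class v bv) κ

        M : Bool
        M = ∑² (λ v → onBoundary v ∧ σ v)

        equation : Bool → ℕ → Bool
        equation μ κ = (μ ∧ α κ) xor (μ ∧ α′ κ) xor π κ

        parity-equation : ∀ κ → equation M κ ≡ false
        parity-equation κ = begin
          equation M κ
            ≡⟨ cong₂ (λ μ ι → (M ∧ α κ) xor (μ ∧ α′ κ) xor (ι ∧ π κ)) M≡M′ (sym (interior-odd odd-s odd-t)) ⟩
          (M ∧ α κ) xor (∑² (λ v → onBoundary v ∧ not (σ v)) ∧ α′ κ) xor (∑² onInterior ∧ π κ)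
            ≡⟨ region-parity onBoundary σ α α′ π profile κ ⟩
          false ∎
          where
          M≡M′ : M ≡ ∑² (λ v → onBoundary v ∧ not (σ v))
          M≡M′ = xor≡false⇒≡ (trans (∑²-split onBoundary σ) boundary-even)

        M≡true : M ≡ true
        M≡true with M in eM
        ... | true  = refl
        ... | false =
          ⊥-elim (not-¬ (right-colour-inPalette w₀) (subst (λ μ → equation μ κ ≡ false) eM (parity-equation κ)))
          where
          κ : ℕ
          κ = colourAt w₀ right

        π≡α⊕α′ : ∀ κ → π κ ≡ α κ xor α′ κ
        π≡α⊕α′ κ =
          xor-solve (α κ) (α′ κ) (π κ) (subst (λ μ → equation μ κ ≡ false) M≡true (parity-equation κ))

        fiveColours : List ℕ
        fiveColours = colourAt v₀ right ∷ colourAt v₀ left ∷ colourAt v₀ up ∷ colourAt u right ∷ colourAt u left ∷ []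

        -- Otherwise the five colours of v₀ and u all lie in the four-colour palette π.
        common-colour : ∃ λ x → α x ≡ true × α′ x ≡ true
        common-colour with Any.any? (λ c → (α c ∧ α′ c) Bool.≟ true) fiveColours
        ... | yes found = proj₁ (Any.satisfied found) , ∧-true (proj₂ (Any.satisfied found))
        ... | no none with ¬Any⇒All¬ fiveColours none
        ...   | ¬r₀ ∷ ¬l₀ ∷ ¬u₀ ∷ ¬r ∷ ¬l ∷ [] =
          ⊥-elim (<-irrefl refl (distinct-⊆⇒length-≤ ℕ._≟_ fiveColours-distinct fiveColours⊆coloursAround-w₀))
          where
          in-v₀ : ∀ d → Avail (proj₂ v₀) d → α (colourAt v₀ d) ≡ true
          in-v₀ d a = palette⇒inPalette {v = v₀} (colourAt∈palette {v₀} d a)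
          in-u : ∀ d → Avail (proj₂ u) d → α′ (colourAt u d) ≡ true
          in-u d a = palette⇒inPalette {v = u} (colourAt∈palette {u} d a)

          r₀-false : α′ (colourAt v₀ right) ≡ false
          r₀-false = true∧¬true⇒false (in-v₀ right tt) ¬r₀
          l₀-false : α′ (colourAt v₀ left) ≡ false
          l₀-false = true∧¬true⇒false (in-v₀ left tt) ¬l₀
          u₀-false : α′ (colourAt v₀ up) ≡ false
          u₀-false = true∧¬true⇒false (in-v₀ up 0<m) ¬u₀
          r-false : α (colourAt u right) ≡ false
          r-false = ¬true∧true⇒false (in-u right tt) ¬r
          l-false : α (colourAt u left) ≡ false
          l-false = ¬true∧true⇒false (in-u left tt) ¬l

          separated : ∀ {c c′} → α′ c ≡ false → α′ c′ ≡ true → c ≢ c′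
          separated c∉ c′∈ refl = false≢true (trans (sym c∉) c′∈)

          fiveColours-distinct : AllPairs _≢_ fiveColours
          fiveColours-distinct =
            (colourAt-apart right left tt tt (λ ()) ∷ colourAt-apart right up tt 0<m (λ ()) ∷
             separated r₀-false (in-u right tt) ∷ separated r₀-false (in-u left tt) ∷ []) ∷
            (colourAt-apart left up tt 0<m (λ ()) ∷
             separated l₀-false (in-u right tt) ∷ separated l₀-false (in-u left tt) ∷ []) ∷
            (separated u₀-false (in-u right tt) ∷ separated u₀-false (in-u left tt) ∷ []) ∷
            (colourAt-apart {u} right left tt tt (λ ()) ∷ []) ∷ [] ∷ []

          in-π : ∀ {c} → π c ≡ true → c ∈ coloursAround w₀
          in-π {c} πc = palette⊆coloursAround (inPalette-sound {c} {w₀} πc)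

          fiveColours⊆coloursAround-w₀ : All (_∈ coloursAround w₀) fiveColours
          fiveColours⊆coloursAround-w₀ =
            in-π (trans (π≡α⊕α′ _) (cong₂ _xor_ (in-v₀ right tt) r₀-false)) ∷
            in-π (trans (π≡α⊕α′ _) (cong₂ _xor_ (in-v₀ left tt) l₀-false)) ∷
            in-π (trans (π≡α⊕α′ _) (cong₂ _xor_ (in-v₀ up 0<m) u₀-false)) ∷
            in-π (trans (π≡α⊕α′ _) (cong₂ _xor_ r-false (in-u right tt))) ∷
            in-π (trans (π≡α⊕α′ _) (cong₂ _xor_ l-false (in-u left tt))) ∷ []

        x : ℕ
        x = proj₁ common-colour

        boundary-has-x : ∀ v → onBoundary v ≡ true → inPalette x v ≡ true
        boundary-has-x v bv with class v Fin.≟ a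
        ... | yes v~a = trans (same-class⇒inPalette v~a x) (proj₁ (proj₂ common-colour))
        ... | no v≁a  = trans (same-class⇒inPalette (boundary-class v bv v≁a) x) (proj₂ (proj₂ common-colour))

        interior-lacks-x : ∀ w → onBoundary w ≡ false → inPalette x w ≡ false
        interior-lacks-x w iw =
          trans (same-class⇒inPalette (interior-class w iw) x)
                (trans (π≡α⊕α′ x) (cong₂ _xor_ (proj₁ (proj₂ common-colour)) (proj₂ (proj₂ common-colour))))

        -- x is in every boundary palette and no interior one, so at each bottom vertex the
        -- x-edge is horizontal: the x-edges of the bottom row perfectly match the odd cycle.
        bottom-edge-has-x : Fin (suc n) → Bool
        bottom-edge-has-x i = does (colourAt (i , zero) right ℕ.≟ x)

        bottom-edges-alternate : ∀ {i i′} → CycSucc (suc n) i i′ → bottom-edge-has-x i′ ≡ not (bottom-edge-has-x i)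
        bottom-edges-alternate {i} {i′} c
          with palette⇒colourAt (inPalette-sound {x} {i′ , zero} (boundary-has-x (i′ , zero) v₀-boundary))
        ... | right , _ , r≡x = trans (dec-true (colourAt (i′ , zero) right ℕ.≟ x) r≡x)
                                      (cong not (sym (dec-false (colourAt (i , zero) right ℕ.≟ x) left≢x)))
          where
          left≢x : colourAt (i , zero) right ≢ x
          left≢x l≡x =
            colourAt-apart {i′ , zero} right left tt tt (λ ()) (trans r≡x (sym (trans (left≡right c) l≡x)))
        ... | left , _ , l≡x = trans (dec-false (colourAt (i′ , zero) right ℕ.≟ x) right≢x)
                                     (cong not (sym (dec-true (colourAt (i , zero) right ℕ.≟ x)
                                                              (trans (sym (left≡right c)) l≡x))))
          where
          right≢x : colourAt (i′ , zero) right ≢ x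
          right≢x r≡x = colourAt-apart {i′ , zero} right left tt tt (λ ()) (trans r≡x (sym l≡x))
        ... | up , 0<m′ , u≡x =
          ⊥-elim (not-¬ (interior-lacks-x up-neighbour (row₁-interior (proj₁ step))) x-up-neighbour)
          where
          up-neighbour : Vertex
          up-neighbour = neighbour (i′ , zero) up
          step : Step (i′ , zero) up up-neighbour
          step = neighbour-step (i′ , zero) up 0<m′
          x-up-neighbour : inPalette x up-neighbour ≡ true
          x-up-neighbour = palette⇒inPalette {v = up-neighbour}
                      ((i′ , zero) , step⇒adj down (step-opposite up step) ,
                       trans (symm f (step⇒adj down (step-opposite up step))) u≡x)

        contradiction : ⊥
        contradiction = odd-cycle-no-alternation odd-s bottom-edge-has-x bottom-edges-alternate

      module OneBoundaryClass (boundary-class : ∀ v → onBoundary v ≡ true → class v ≡ a) (w₁ : Vertex)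
                              (interior-class : ∀ w → onBoundary w ≡ false → class w ≡ p ⊎ class w ≡ class w₁) where

        π₁ : ℕ → Bool
        π₁ κ = inPalette κ w₁

        σ : Vertex → Bool
        σ v = does (class v Fin.≟ p)

        profile : ∀ κ v → inPalette κ v ≡ (if onInterior v then (if σ v then π κ else π₁ κ) else α κ)
        profile κ v with onBoundary v in bv | class v Fin.≟ p
        ... | true  | _       = same-class⇒inPalette (boundary-class v bv) κ
        ... | false | yes v~p = same-class⇒inPalette v~p κ
        ... | false | no v≁p with interior-class v bv
        ...   | inj₁ v~p = ⊥-elim (v≁p v~p)
        ...   | inj₂ v~w₁ = same-class⇒inPalette v~w₁ κ

        N : Bool
        N = ∑² (λ v → onInterior v ∧ σ v)

        equation : Bool → ℕ → Bool
        equation ν κ = (ν ∧ π κ) xor (not ν ∧ π₁ κ)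

        parity-equation : ∀ κ → equation N κ ≡ false
        parity-equation κ = begin
          equation N κ
            ≡⟨ cong ((N ∧ π κ) xor_) (sym (xor-identityʳ _)) ⟩
          (N ∧ π κ) xor (not N ∧ π₁ κ) xor false
            ≡⟨ cong₂ (λ ν β → (N ∧ π κ) xor (ν ∧ π₁ κ) xor (β ∧ α κ)) ¬N≡N′ (sym boundary-even′) ⟩
          (N ∧ π κ) xor (∑² (λ v → onInterior v ∧ not (σ v)) ∧ π₁ κ) xor (∑² (not ∘ onInterior) ∧ α κ)
            ≡⟨ region-parity onInterior σ π π₁ α profile κ ⟩
          false ∎
          where
          ¬N≡N′ : not N ≡ ∑² (λ v → onInterior v ∧ not (σ v))
          ¬N≡N′ = sym (xor≡true⇒≡not (trans (∑²-split onInterior σ) (interior-odd odd-s odd-t)))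
          boundary-even′ : ∑² (not ∘ onInterior) ≡ false
          boundary-even′ = trans (∑²-cong (λ v → not-involutive (onBoundary v))) boundary-even

        contradiction : ⊥
        contradiction with N in eN
        ... | true  = not-¬ (right-colour-inPalette w₀)
                            (trans (sym (xor-identityʳ _)) (subst (λ ν → equation ν κ ≡ false) eN (parity-equation κ)))
          where
          κ : ℕ
          κ = colourAt w₀ right
        ... | false = not-¬ (right-colour-inPalette w₁) (subst (λ ν → equation ν κ ≡ false) eN (parity-equation κ))
          where
          κ : ℕ
          κ = colourAt w₁ right

      boundary-in-one-class : ¬ (∃ λ u → onBoundary u ≡ true × class u ≢ a) →
                              ∀ v → onBoundary v ≡ true → class v ≡ a
      boundary-in-one-class none v bv with class v Fin.≟ a
      ... | yes v~a = v~a
      ... | no v≁a  = ⊥-elim (none (v , bv , v≁a))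

      interior-in-two-classes : ∀ w₁ → onBoundary w₁ ≡ false → class w₁ ≢ p →
                                ∀ w → onBoundary w ≡ false → class w ≡ p ⊎ class w ≡ class w₁
      interior-in-two-classes w₁ iw₁ w₁≁p w iw with class w Fin.≟ p
      ... | yes w~p = inj₁ w~p
      ... | no w≁p  =
        inj₂ (fin≤3-third k≤3 ((a≢p ∷ classes-apart v₀ w₁ v₀-boundary iw₁ ∷ []) ∷ (w₁≁p ∘ sym ∷ []) ∷ [] ∷ [])
                          (classes-apart v₀ w v₀-boundary iw ∘ sym) w≁p)

      interior-in-one-class : ¬ (∃ λ w → onBoundary w ≡ false × class w ≢ p) →
                              ∀ w → onBoundary w ≡ false → class w ≡ p ⊎ class w ≡ class w₀
      interior-in-one-class none w iw with class w Fin.≟ p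
      ... | yes w~p = inj₁ w~p
      ... | no w≁p  = ⊥-elim (none (w , iw , w≁p))

      -- Boundary and interior classes are disjoint, so with at most three classes either
      -- the boundary has two classes and the interior one, or the boundary has one.
      impossible : ⊥
      impossible with vertex? (λ v → (onBoundary v Bool.≟ true) ×-dec ¬? (class v Fin.≟ a))
      ... | yes (u , bu , u≁a) = TwoBoundaryClasses.contradiction u bu u≁a
      ... | no none with vertex? (λ w → (onBoundary w Bool.≟ false) ×-dec ¬? (class w Fin.≟ p))
      ...   | yes (w₁ , iw₁ , w₁≁p) =
                OneBoundaryClass.contradiction (boundary-in-one-class none) w₁ (interior-in-two-classes w₁ iw₁ w₁≁p)
      ...   | no none′ =
                OneBoundaryClass.contradiction (boundary-in-one-class none) w₀ (interior-in-one-class none′)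

    palettes≥4 : Odd (suc n) → Odd (suc m) → ∀ {k} → AtMostPalettes G f k → 4 ≤ k
    palettes≥4 odd-s odd-t {k} cover with 4 ℕ.≤? k
    ... | yes 4≤k = 4≤k
    ... | no 4≰k  = ⊥-elim (NoThreePalettes.impossible odd-s odd-t (s≤s⁻¹ (≰⇒> 4≰k)) cover)

-- Colourings determined by local designs

-- Along a row (resp. column) an edge is alternating p when its lower end has parity p,
-- except for the closing edge from the last column to the first (resp. into the top row).
data EdgeKind : Set where
  alternating : Bool → EdgeKind
  closing     : EdgeKind

data ColumnType : Set where
  firstColumn             : ColumnType
  innerColumn lastColumn  : Bool → ColumnType

data RowType : Set where
  bottomRow topRow           : RowType
  innerRow penultimateRow    : Bool → RowType

leftEdge rightEdge : ColumnType → EdgeKind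
leftEdge firstColumn      = closing
leftEdge (innerColumn p)  = alternating (not p)
leftEdge (lastColumn p)   = alternating (not p)
rightEdge firstColumn     = alternating false
rightEdge (innerColumn p) = alternating p
rightEdge (lastColumn _)  = closing

downEdge upEdge : RowType → Maybe EdgeKind
downEdge bottomRow          = nothing
downEdge (innerRow p)       = just (alternating (not p))
downEdge (penultimateRow p) = just (alternating (not p))
downEdge topRow             = just closing
upEdge bottomRow            = just (alternating false)
upEdge (innerRow p)         = just (alternating p)
upEdge (penultimateRow _)   = just closing
upEdge topRow               = nothing

-- The types occurring when the last column, resp. the penultimate row, has index parity p.
columnTypes : Bool → List ColumnType
columnTypes p = firstColumn ∷ innerColumn false ∷ innerColumn true ∷ lastColumn p ∷ []

rowTypes : Bool → List RowType
rowTypes p = bottomRow ∷ innerRow false ∷ innerRow true ∷ penultimateRow p ∷ topRow ∷ []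

-- Type of column x (resp. row y) at distance d from the last column (resp. top row).
columnTypeℕ : ℕ → ℕ → ColumnType
columnTypeℕ zero    _       = firstColumn
columnTypeℕ (suc x) zero    = lastColumn (parity (suc x))
columnTypeℕ (suc x) (suc _) = innerColumn (parity (suc x))

rowTypeℕ : ℕ → ℕ → RowType
rowTypeℕ _       zero          = topRow
rowTypeℕ y       (suc zero)    = penultimateRow (parity y)
rowTypeℕ zero    (suc (suc _)) = bottomRow
rowTypeℕ (suc y) (suc (suc _)) = innerRow (parity (suc y))

columnTypeℕ∈ : ∀ x d {k} → d + x ≡ k → columnTypeℕ x d ∈ columnTypes (parity k)
columnTypeℕ∈ zero    _       _    = here refl
columnTypeℕ∈ (suc x) zero    refl = there (there (there (here refl)))
columnTypeℕ∈ (suc x) (suc _) _    with parity (suc x)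
... | false = there (here refl)
... | true  = there (there (here refl))

rowTypeℕ∈ : ∀ y d {k} → d + y ≡ k → rowTypeℕ y d ∈ rowTypes (not (parity k))
rowTypeℕ∈ _       zero          _    = there (there (there (there (here refl))))
rowTypeℕ∈ y       (suc zero)    refl =
  there (there (there (here (cong penultimateRow (sym (not-involutive (parity y)))))))
rowTypeℕ∈ zero    (suc (suc _)) _    = here refl
rowTypeℕ∈ (suc y) (suc (suc _)) _    with parity (suc y)
... | false = there (here refl)
... | true  = there (there (here refl))

columnTypeℕ-coherent : ∀ x d → rightEdge (columnTypeℕ x (suc d)) ≡ leftEdge (columnTypeℕ (suc x) d)
columnTypeℕ-coherent zero    zero    = refl
columnTypeℕ-coherent zero    (suc _) = refl
columnTypeℕ-coherent (suc x) zero    = cong alternating (sym (not-involutive _))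
columnTypeℕ-coherent (suc x) (suc _) = cong alternating (sym (not-involutive _))

rowTypeℕ-coherent : ∀ y d → upEdge (rowTypeℕ y (suc d)) ≡ downEdge (rowTypeℕ (suc y) d)
rowTypeℕ-coherent y       zero          = refl
rowTypeℕ-coherent zero    (suc zero)    = refl
rowTypeℕ-coherent zero    (suc (suc _)) = refl
rowTypeℕ-coherent (suc y) (suc zero)    = cong (just ∘ alternating) (sym (not-involutive _))
rowTypeℕ-coherent (suc y) (suc (suc _)) = cong (just ∘ alternating) (sym (not-involutive _))

∸-suc-gap : ∀ {x k} → x < k → k ∸ x ≡ suc (k ∸ suc x)
∸-suc-gap {zero}  {suc k} _         = refl
∸-suc-gap {suc x} {suc k} (s≤s x<k) = ∸-suc-gap x<k

Apart : Maybe ℕ → Maybe ℕ → Set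
Apart (just a) (just b) = a ≢ b
Apart _        _        = ⊤

apart? : ∀ x y → Dec (Apart x y)
apart? (just a) (just b) = ¬? (a ℕ.≟ b)
apart? (just _) nothing  = yes tt
apart? nothing  _        = yes tt

Apart-sym : ∀ x y → Apart x y → Apart y x
Apart-sym (just _) (just _) a≢b = a≢b ∘ sym
Apart-sym (just _) nothing  _   = tt
Apart-sym nothing  (just _) _   = tt
Apart-sym nothing  nothing  _   = tt

apart-directions : ∀ (g : Dir → Maybe ℕ) → AllPairs Apart (map g (right ∷ left ∷ up ∷ down ∷ [])) →
                   ∀ d d′ → d ≢ d′ → Apart (g d) (g d′)
apart-directions g ((rl ∷ ru ∷ rd ∷ []) ∷ (lu ∷ ld ∷ []) ∷ (ud ∷ []) ∷ [] ∷ []) = go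
  where
  go : ∀ d d′ → d ≢ d′ → Apart (g d) (g d′)
  go right left  _ = rl
  go right up    _ = ru
  go right down  _ = rd
  go left  up    _ = lu
  go left  down  _ = ld
  go up    down  _ = ud
  go left  right _ = Apart-sym (g right) (g left) rl
  go up    right _ = Apart-sym (g right) (g up) ru
  go down  right _ = Apart-sym (g right) (g down) rd
  go up    left  _ = Apart-sym (g left) (g up) lu
  go down  left  _ = Apart-sym (g left) (g down) ld
  go down  up    _ = Apart-sym (g up) (g down) ud
  go right right ne = ⊥-elim (ne refl)
  go left  left  ne = ⊥-elim (ne refl)
  go up    up    ne = ⊥-elim (ne refl)
  go down  down  ne = ⊥-elim (ne refl)

nothing≢just : ∀ {A : Set} {x : A} → nothing ≢ just x
nothing≢just ()

map-defined : ∀ {A B : Set} {x : Maybe A} (g : A → B) (b : B) → x ≢ nothing →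
              Maybe.map g x ≡ just (Maybe.fromMaybe b (Maybe.map g x))
map-defined {x = just _}  _ _ _         = refl
map-defined {x = nothing} _ _ x≢nothing = ⊥-elim (x≢nothing refl)

∈-catMaybes⁺ : ∀ {A : Set} {x : A} {xs} → just x ∈ xs → x ∈ catMaybes xs
∈-catMaybes⁺ {xs = just _ ∷ _}  (here refl) = here refl
∈-catMaybes⁺ {xs = just _ ∷ _}  (there p)   = there (∈-catMaybes⁺ p)
∈-catMaybes⁺ {xs = nothing ∷ _} (there p)   = ∈-catMaybes⁺ p

∈-catMaybes⁻ : ∀ {A : Set} {x : A} {xs} → x ∈ catMaybes xs → just x ∈ xs
∈-catMaybes⁻ {xs = just _ ∷ _}  (here refl) = here refl
∈-catMaybes⁻ {xs = just _ ∷ _}  (there p)   = there (∈-catMaybes⁻ p)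
∈-catMaybes⁻ {xs = nothing ∷ _} p           = there (∈-catMaybes⁻ p)

-- A design colours a horizontal edge by its kind and row type, and a vertical edge by its
-- column type and kind; Fits c r says that at a vertex of type (c , r) the colours are
-- distinct and are exactly palette (class c r).
record Design (k : ℕ) : Set where
  field
    horizontal : EdgeKind → RowType → ℕ
    vertical   : ColumnType → EdgeKind → ℕ
    class      : ColumnType → RowType → Fin k
    palette    : Fin k → List ℕ

  slot : ColumnType → RowType → Dir → Maybe ℕ
  slot c r right = just (horizontal (rightEdge c) r)
  slot c r left  = just (horizontal (leftEdge c) r)
  slot c r up    = Maybe.map (vertical c) (upEdge r)
  slot c r down  = Maybe.map (vertical c) (downEdge r)

  slots : ColumnType → RowType → List (Maybe ℕ)
  slots c r = map (slot c r) (right ∷ left ∷ up ∷ down ∷ [])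

  slot∈slots : ∀ {c r} d → slot c r d ∈ slots c r
  slot∈slots right = here refl
  slot∈slots left  = there (here refl)
  slot∈slots up    = there (there (here refl))
  slot∈slots down  = there (there (there (here refl)))

  Fits : ColumnType → RowType → Set
  Fits c r = AllPairs Apart (slots c r) ×
             catMaybes (slots c r) ⊆ palette (class c r) × palette (class c r) ⊆ catMaybes (slots c r)

  Valid : List ColumnType → List RowType → Set
  Valid cs rs = All (λ c → All (Fits c) rs) cs

  valid? : ∀ cs rs → Dec (Valid cs rs)
  valid? cs rs =
    All.all? (λ c → All.all? (λ r → allPairs? apart? (slots c r) ×-dec (_ ⊆? _) ×-dec (_ ⊆? _)) rs) cs

-- Every row alike; each column alternates 4 with the colour its row colouring misses there.
evenPathDesign : Design 2
evenPathDesign = record { horizontal = horizontal ; vertical = vertical ; class = class ; palette = palette }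
  where
  horizontal : EdgeKind → RowType → ℕ
  horizontal (alternating false) _ = 1
  horizontal (alternating true)  _ = 2
  horizontal closing             _ = 3

  vertical : ColumnType → EdgeKind → ℕ
  vertical _                  (alternating true) = 4
  vertical firstColumn        _                  = 2
  vertical (innerColumn _)    _                  = 3
  vertical (lastColumn false) _                  = 1
  vertical (lastColumn true)  _                  = 2

  class : ColumnType → RowType → Fin 2
  class _ bottomRow = zero
  class _ topRow    = zero
  class _ _         = suc zero

  palette : Fin 2 → List ℕ
  palette zero       = 1 ∷ 2 ∷ 3 ∷ []
  palette (suc zero) = 1 ∷ 2 ∷ 3 ∷ 4 ∷ []

evenPathDesign-valid : ∀ p → Design.Valid evenPathDesign (columnTypes p) (rowTypes false)
evenPathDesign-valid false = toWitness {a? = Design.valid? evenPathDesign (columnTypes false) (rowTypes false)} tt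
evenPathDesign-valid true  = toWitness {a? = Design.valid? evenPathDesign (columnTypes true) (rowTypes false)} tt

evenCycleDesign : Design 2
evenCycleDesign = record { horizontal = horizontal ; vertical = vertical ; class = class ; palette = palette }
  where
  horizontal : EdgeKind → RowType → ℕ
  horizontal (alternating false) (penultimateRow _) = 4
  horizontal (alternating true)  (penultimateRow _) = 1
  horizontal closing             (penultimateRow _) = 3
  horizontal (alternating false) topRow             = 3
  horizontal (alternating true)  topRow             = 1
  horizontal closing             topRow             = 2
  horizontal (alternating false) _                  = 1
  horizontal (alternating true)  _                  = 2
  horizontal closing             _                  = 3

  vertical : ColumnType → EdgeKind → ℕ
  vertical _               (alternating true)  = 4
  vertical (innerColumn _) (alternating false) = 3
  vertical (innerColumn _) closing             = 2
  vertical _               (alternating false) = 2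
  vertical _               closing             = 1

  class : ColumnType → RowType → Fin 2
  class _ bottomRow = zero
  class _ topRow    = zero
  class _ _         = suc zero

  palette : Fin 2 → List ℕ
  palette zero       = 1 ∷ 2 ∷ 3 ∷ []
  palette (suc zero) = 1 ∷ 2 ∷ 3 ∷ 4 ∷ []

evenCycleDesign-valid : Design.Valid evenCycleDesign (columnTypes true) (rowTypes true)
evenCycleDesign-valid = toWitness {a? = Design.valid? evenCycleDesign (columnTypes true) (rowTypes true)} tt

oddOddDesign : Design 4
oddOddDesign = record { horizontal = horizontal ; vertical = vertical ; class = class ; palette = palette }
  where
  horizontal : EdgeKind → RowType → ℕ
  horizontal (alternating false) _                  = 1
  horizontal (alternating true)  topRow             = 5
  horizontal (alternating true)  _                  = 2
  horizontal closing             (penultimateRow _) = 4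
  horizontal closing             topRow             = 2
  horizontal closing             _                  = 3

  vertical : ColumnType → EdgeKind → ℕ
  vertical _               (alternating true)  = 4
  vertical (innerColumn _) (alternating false) = 3
  vertical (innerColumn _) closing             = 4
  vertical firstColumn     (alternating false) = 2
  vertical (lastColumn _)  (alternating false) = 1
  vertical _               closing             = 3

  class : ColumnType → RowType → Fin 4
  class _               bottomRow = zero
  class firstColumn     topRow    = zero
  class (innerColumn _) topRow    = suc (suc zero)
  class (lastColumn _)  topRow    = suc (suc (suc zero))
  class _               _         = suc zero

  palette : Fin 4 → List ℕ
  palette zero                   = 1 ∷ 2 ∷ 3 ∷ []
  palette (suc zero)             = 1 ∷ 2 ∷ 3 ∷ 4 ∷ []
  palette (suc (suc zero))       = 1 ∷ 4 ∷ 5 ∷ []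
  palette (suc (suc (suc zero))) = 2 ∷ 3 ∷ 5 ∷ []

oddOddDesign-valid : Design.Valid oddOddDesign (columnTypes false) (rowTypes true)
oddOddDesign-valid = toWitness {a? = Design.valid? oddOddDesign (columnTypes false) (rowTypes true)} tt

-- Upper bounds

module UpperBound (n m : ℕ) (2≤n : 2 ≤ n) (2≤m : 2 ≤ m) where

  open Grid n m

  vertical-direction : Fin (suc m) → Fin (suc m) → Dir
  vertical-direction j j′ = if does (toℕ j′ ℕ.≟ suc (toℕ j)) then up else down

  direction : Vertex → Vertex → Dir
  direction (i , j) (i′ , j′) =
    if does (cycSucc? i i′) then right else if does (cycSucc? i′ i) then left else vertical-direction j j′

  direction-same-column : ∀ i j j′ → direction (i , j) (i , j′) ≡ vertical-direction j j′
  direction-same-column i j j′ =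
    cong (λ b → if b then right else if b then left else vertical-direction j j′)
         (dec-false (cycSucc? i i) (cycSucc-irrefl 2≤n))

  direction-step : ∀ {v u} d → Step v d u → direction v u ≡ d
  direction-step {i , j} {i′ , j′} right (c , _) =
    cong (λ b → if b then right else if does (cycSucc? i′ i) then left else vertical-direction j j′)
         (dec-true (cycSucc? i i′) c)
  direction-step {i , j} {i′ , j′} left (c , _) =
    trans (cong (λ b → if b then right else if does (cycSucc? i′ i) then left else vertical-direction j j′)
                (dec-false (cycSucc? i i′) (cycSucc-asym 2≤n c)))
          (cong (λ b → if b then left else vertical-direction j j′) (dec-true (cycSucc? i′ i) c))
  direction-step {i , j} {_ , j′} up (e , refl) =
    trans (direction-same-column i j j′)
          (cong (if_then up else down) (dec-true (toℕ j′ ℕ.≟ suc (toℕ j)) e))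
  direction-step {i , j} {_ , j′} down (e , refl) =
    trans (direction-same-column i j j′)
          (cong (if_then up else down)
                (dec-false (toℕ j′ ℕ.≟ suc (toℕ j)) (λ e′ → n≢2+n (trans e (cong suc e′)))))

  module FromLabels (label : Vertex → Dir → ℕ)
                    (consistent : ∀ {v u} d → Step v d u → label v d ≡ label u (opposite d)) where

    colouring : EdgeColoring G
    colouring = record { col = λ v u → label v (direction v u) ; symm = symmetric }
      where
      symmetric : ∀ {v u} → Adj G v u → label v (direction v u) ≡ label u (direction u v)
      symmetric {v} {u} v~u with adj⇒step v~u
      ... | d , step = begin
        label v (direction v u) ≡⟨ cong (label v) (direction-step d step) ⟩
        label v d               ≡⟨ consistent d step ⟩
        label u (opposite d)    ≡⟨ cong (label u) (sym (direction-step (opposite d) (step-opposite d step))) ⟩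
        label u (direction u v) ∎

    palette⇔label : ∀ {v k} → Palette G colouring v k ⇔ (∃ λ d → Avail (proj₂ v) d × label v d ≡ k)
    palette⇔label {v} = mk⇔ to from
      where
      to : ∀ {k} → Palette G colouring v k → ∃ λ d → Avail (proj₂ v) d × label v d ≡ k
      to (u , v~u , refl) with adj⇒step v~u
      ... | d , step = d , step-avail d step , cong (label v) (sym (direction-step d step))
      from : ∀ {k} → (∃ λ d → Avail (proj₂ v) d × label v d ≡ k) → Palette G colouring v k
      from (d , a , refl) = neighbour v d , step⇒adj d step , cong (label v) (direction-step d step)
        where step = neighbour-step v d a

    proper : (∀ v d d′ → Avail (proj₂ v) d → Avail (proj₂ v) d′ → d ≢ d′ → label v d ≢ label v d′) →
             Proper G colouring
    proper injective {v} {u} {w} v~u v~w u≢w with adj⇒step v~u | adj⇒step v~w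
    ... | d , step | d′ , step′ = λ same →
      injective v d d′ (step-avail d step) (step-avail d′ step′) d≢d′
        (trans (cong (label v) (sym (direction-step d step)))
               (trans same (cong (label v) (direction-step d′ step′))))
      where
      d≢d′ : d ≢ d′
      d≢d′ refl = u≢w (step-functional step step′)

  columnType : Fin (suc n) → ColumnType
  columnType i = columnTypeℕ (toℕ i) (n ∸ toℕ i)

  rowType : Fin (suc m) → RowType
  rowType j = rowTypeℕ (toℕ j) (m ∸ toℕ j)

  column-coherent : ∀ {i i′} → CycSucc (suc n) i i′ → rightEdge (columnType i) ≡ leftEdge (columnType i′)
  column-coherent {i} {i′} (inj₁ i′≡1+i) = begin
    rightEdge (columnTypeℕ x (n ∸ x))              ≡⟨ cong (rightEdge ∘ columnTypeℕ x) (∸-suc-gap x<n) ⟩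
    rightEdge (columnTypeℕ x (suc (n ∸ suc x)))    ≡⟨ columnTypeℕ-coherent x (n ∸ suc x) ⟩
    leftEdge (columnTypeℕ (suc x) (n ∸ suc x))     ≡⟨ cong (λ y → leftEdge (columnTypeℕ y (n ∸ y))) (sym i′≡1+i) ⟩
    leftEdge (columnType i′)                       ∎
    where
    x : ℕ
    x = toℕ i
    x<n : x < n
    x<n = s≤s⁻¹ (subst (_< suc n) i′≡1+i (toℕ<n i′))
  column-coherent {i} {i′} (inj₂ (1+i≡1+n , i′≡0)) = begin
    rightEdge (columnType i)           ≡⟨ cong (λ x → rightEdge (columnTypeℕ x (n ∸ x))) (suc-injective 1+i≡1+n) ⟩
    rightEdge (columnTypeℕ n (n ∸ n))  ≡⟨ cong (rightEdge ∘ columnTypeℕ n) (n∸n≡0 n) ⟩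
    rightEdge (columnTypeℕ n 0)        ≡⟨ last-closing n (≤-trans (s≤s z≤n) 2≤n) ⟩
    closing                            ≡⟨ cong (λ x → leftEdge (columnTypeℕ x (n ∸ x))) (sym i′≡0) ⟩
    leftEdge (columnType i′)           ∎
    where
    last-closing : ∀ x → 0 < x → rightEdge (columnTypeℕ x 0) ≡ closing
    last-closing (suc _) _ = refl

  row-coherent : ∀ {j j′} → toℕ j′ ≡ suc (toℕ j) → upEdge (rowType j) ≡ downEdge (rowType j′)
  row-coherent {j} {j′} j′≡1+j = begin
    upEdge (rowTypeℕ y (m ∸ y))              ≡⟨ cong (upEdge ∘ rowTypeℕ y) (∸-suc-gap y<m) ⟩
    upEdge (rowTypeℕ y (suc (m ∸ suc y)))    ≡⟨ rowTypeℕ-coherent y (m ∸ suc y) ⟩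
    downEdge (rowTypeℕ (suc y) (m ∸ suc y))  ≡⟨ cong (λ z → downEdge (rowTypeℕ z (m ∸ z))) (sym j′≡1+j) ⟩
    downEdge (rowType j′)                    ∎
    where
    y : ℕ
    y = toℕ j
    y<m : y < m
    y<m = s≤s⁻¹ (subst (_< suc m) j′≡1+j (toℕ<n j′))

  up-defined : ∀ {j} → toℕ j < m → upEdge (rowType j) ≢ nothing
  up-defined {j} j<m =
    subst (λ d → upEdge (rowTypeℕ (toℕ j) d) ≢ nothing) (sym (∸-suc-gap j<m)) (defined (toℕ j) _)
    where
    defined : ∀ y d → upEdge (rowTypeℕ y (suc d)) ≢ nothing
    defined y       zero          ()
    defined zero    (suc (suc _)) ()
    defined (suc y) (suc (suc _)) ()

  up-undefined : ∀ {j} → toℕ j ≡ m → upEdge (rowType j) ≡ nothing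
  up-undefined {j} j≡m = cong (upEdge ∘ rowTypeℕ (toℕ j)) (subst (λ y → m ∸ y ≡ 0) (sym j≡m) (n∸n≡0 m))

  down-defined : ∀ {j} → 0 < toℕ j → downEdge (rowType j) ≢ nothing
  down-defined {j} 0<j = defined (toℕ j) (m ∸ toℕ j) 0<j
    where
    defined : ∀ y d → 0 < y → downEdge (rowTypeℕ y d) ≢ nothing
    defined (suc y) zero          _ ()
    defined (suc y) (suc zero)    _ ()
    defined (suc y) (suc (suc _)) _ ()

  down-undefined : ∀ {j} → toℕ j ≡ 0 → downEdge (rowType j) ≡ nothing
  down-undefined {j} j≡0 = subst (λ y → downEdge (rowTypeℕ y (m ∸ y)) ≡ nothing) (sym j≡0) (bottom m 2≤m)
    where
    bottom : ∀ d → 2 ≤ d → downEdge (rowTypeℕ 0 d) ≡ nothing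
    bottom (suc (suc _)) _              = refl
    bottom (suc zero)    (s≤s ())

  columnType∈ : ∀ i → columnType i ∈ columnTypes (parity n)
  columnType∈ i = columnTypeℕ∈ (toℕ i) (n ∸ toℕ i) (m∸n+n≡m (s≤s⁻¹ (toℕ<n i)))

  rowType∈ : ∀ j → rowType j ∈ rowTypes (not (parity m))
  rowType∈ j = rowTypeℕ∈ (toℕ j) (m ∸ toℕ j) (m∸n+n≡m (s≤s⁻¹ (toℕ<n j)))

  ProperColouringWithin : ℕ → Set
  ProperColouringWithin k = Σ (EdgeColoring G) λ f → Proper G f × AtMostPalettes G f k

  module Realise {k} (D : Design k)
                 (valid : Design.Valid D (columnTypes (parity n)) (rowTypes (not (parity m)))) where

    open Design D

    slotAt : Vertex → Dir → Maybe ℕ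
    slotAt (i , j) = slot (columnType i) (rowType j)

    label : Vertex → Dir → ℕ
    label v d = Maybe.fromMaybe 0 (slotAt v d)

    slotAt-consistent : ∀ {v u} d → Step v d u → slotAt v d ≡ slotAt u (opposite d)
    slotAt-consistent {_ , j} {_ , _} right (c , refl) = cong (λ e → just (horizontal e (rowType j))) (column-coherent c)
    slotAt-consistent {_ , j} {_ , _} left  (c , refl) = cong (λ e → just (horizontal e (rowType j))) (sym (column-coherent c))
    slotAt-consistent {i , _} {_ , _} up    (e , refl) = cong (Maybe.map (vertical (columnType i))) (row-coherent e)
    slotAt-consistent {i , _} {_ , _} down  (e , refl) = cong (Maybe.map (vertical (columnType i))) (sym (row-coherent e))

    slotAt-avail : ∀ v d → Avail (proj₂ v) d → slotAt v d ≡ just (label v d)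
    slotAt-avail (i , j) right _   = refl
    slotAt-avail (i , j) left  _   = refl
    slotAt-avail (i , j) up    j<m = map-defined (vertical (columnType i)) 0 (up-defined j<m)
    slotAt-avail (i , j) down  0<j = map-defined (vertical (columnType i)) 0 (down-defined 0<j)

    slotAt-just⇒avail : ∀ v d {κ} → slotAt v d ≡ just κ → Avail (proj₂ v) d
    slotAt-just⇒avail (i , j) right _ = tt
    slotAt-just⇒avail (i , j) left  _ = tt
    slotAt-just⇒avail (i , j) up    slot≡just with toℕ j <? m
    ... | yes j<m = j<m
    ... | no j≮m  =
      ⊥-elim (nothing≢just (trans (cong (Maybe.map (vertical (columnType i))) (sym (up-undefined j≡m))) slot≡just))
      where
      j≡m : toℕ j ≡ m
      j≡m = ≤-antisym (s≤s⁻¹ (toℕ<n j)) (≮⇒≥ j≮m)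
    slotAt-just⇒avail (i , j) down  slot≡just with toℕ j ℕ.≟ 0
    ... | no j≢0  = n≢0⇒n>0 j≢0
    ... | yes j≡0 =
      ⊥-elim (nothing≢just (trans (cong (Maybe.map (vertical (columnType i))) (sym (down-undefined j≡0))) slot≡just))

    open FromLabels label (λ d step → cong (Maybe.fromMaybe 0) (slotAt-consistent d step))

    fits : ∀ v → Fits (columnType (proj₁ v)) (rowType (proj₂ v))
    fits (i , j) = All.lookup (All.lookup valid (columnType∈ i)) (rowType∈ j)

    classAt : Vertex → Fin k
    classAt (i , j) = class (columnType i) (rowType j)

    palette⇔class : ∀ v {κ} → Palette G colouring v κ ⇔ κ ∈ palette (classAt v)
    palette⇔class v@(i , j) = mk⇔ to from
      where
      to : ∀ {κ} → Palette G colouring v κ → κ ∈ palette (classAt v)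
      to p with Equivalence.to palette⇔label p
      ... | d , a , refl =
        proj₁ (proj₂ (fits v)) (∈-catMaybes⁺ (subst (_∈ slots _ _) (slotAt-avail v d a) (slot∈slots d)))
      from : ∀ {κ} → κ ∈ palette (classAt v) → Palette G colouring v κ
      from κ∈ with ∈-map⁻ (slot (columnType i) (rowType j)) {xs = right ∷ left ∷ up ∷ down ∷ []}
                          (∈-catMaybes⁻ {xs = slots (columnType i) (rowType j)} (proj₂ (proj₂ (fits v)) κ∈))
      ... | d , _ , just≡slot =
        Equivalence.from palette⇔label
          (d , slotAt-just⇒avail v d (sym just≡slot) , cong (Maybe.fromMaybe 0) (sym just≡slot))

    realisation : ProperColouringWithin k
    realisation = colouring , proper injective , atMostPalettes {colouring} classAt same-palette
      where
      injective : ∀ v d d′ → Avail (proj₂ v) d → Avail (proj₂ v) d′ → d ≢ d′ → label v d ≢ label v d′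
      injective v d d′ a a′ d≢d′ same =
        subst₂ Apart (slotAt-avail v d a) (slotAt-avail v d′ a′)
               (apart-directions (slotAt v) (proj₁ (fits v)) d d′ d≢d′) same
      same-palette : ∀ {v w} → classAt v ≡ classAt w → SamePalette G colouring v w
      same-palette {v} {w} v~w κ = mk⇔
        (Equivalence.from (palette⇔class w) ∘ subst (λ c → κ ∈ palette c) v~w ∘ Equivalence.to (palette⇔class v))
        (Equivalence.from (palette⇔class v) ∘ subst (λ c → κ ∈ palette c) (sym v~w) ∘ Equivalence.to (palette⇔class w))

  realise : ∀ {k} (D : Design k) {p q} → parity n ≡ p → parity m ≡ q →
            Design.Valid D (columnTypes p) (rowTypes (not q)) → ProperColouringWithin k
  realise D refl refl valid = Realise.realisation D valid

  two-palette-colouring : ¬ (Odd (suc n) × Odd (suc m)) → ProperColouringWithin 2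
  two-palette-colouring not-both with parity n in pn | parity m in pm
  ... | p     | true  = realise evenPathDesign pn pm (evenPathDesign-valid p)
  ... | true  | false = realise evenCycleDesign pn pm evenCycleDesign-valid
  ... | false | false = ⊥-elim (not-both (parity⇒odd (suc n) (cong not pn) , parity⇒odd (suc m) (cong not pm)))

  four-palette-colouring : Odd (suc n) → Odd (suc m) → ProperColouringWithin 4
  four-palette-colouring odd-s odd-t =
    realise oddOddDesign (odd-suc⇒parity≡false n odd-s) (odd-suc⇒parity≡false m odd-t) oddOddDesign-valid

theorem4 : (s t : ℕ) → 3 ≤ s → 3 ≤ t →
  (Odd s × Odd t → PaletteIndex (CycBoxPath s t) 4) ×
  (¬ (Odd s × Odd t) → PaletteIndex (CycBoxPath s t) 2)
theorem4 (suc n) (suc m) (s≤s 2≤n) (s≤s 2≤m) =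
  (λ (odd-s , odd-t) → four-palette-colouring odd-s odd-t ,
                       λ f proper k k<4 cover → <-irrefl refl (≤-trans k<4 (palettes≥4 f proper odd-s odd-t cover))) ,
  (λ not-both → two-palette-colouring not-both ,
                λ f proper k k<2 cover → <-irrefl refl (≤-trans k<2 (palettes≥2 f proper cover)))
  where
  open LowerBound n m 2≤n 2≤m
  open UpperBound n m 2≤n 2≤m
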